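{- Let $\mathsf{Gpd}$ be the category of small groupoids and functors and $\mathcal{G}$ the class of normal cloven (Grothendieck) fibrations. The pair $(\mathsf{Gpd}, \mathcal{G})$ is a tribe with stable path objects.
   Context: A functor $p\colon E\to X$ is a Grothendieck fibration if every arrow of $X$ with domain $p(e)$ has a lifting along $p$ (an arrow of $E$ with domain $e$ mapped to it). A cloven fibration is a Grothendieck fibration with a choice of such liftings that is stable under pullback and composition; it is normal if the chosen lifting of an identity is an identity. An arrow $f$ has the left lifting property with respect to $g$ if every commutative square with $f$ on the left and $g$ on the right has a diagonal filler. A tribe is a pair $(\mathsf{C},\mathcal{A})$ where $\mathsf{C}$ has a terminal object and: (a) for every pair of arrows with common codomain, at least one in $\mathcal{A}$, there is a chosen pullback; (b) $\mathcal{A}$ is closed under composition and base change; (c) all isomorphisms and terminal arrows are in $\mathcal{A}$. It has path objects if for every $p\colon E\to Y$ in $\mathcal{A}$ there is a chosen factorization of the diagonal $E\to E\times_pE$ as $\mathrm{r}_p\colon E\to\mathrm{Path}(p)$ followed by $\partial_p=\langle\partial^0_p,\partial^1_p\rangle\colon\mathrm{Path}(p)\to E\times_pE$ with $\partial_p\in\mathcal{A}$ and every base change of $\mathrm{r}_p$ along an arrow of $\mathcal{A}$ having the left lifting property with respect to all arrows of $\mathcal{A}$. For $g\colon X\to E$, $\mathrm{Map}_p(g)$ is the pullback of $g$ along $\partial^0_p$ with projections $\mathrm{pm}_0,\mathrm{pm}_1$. Stable path objects: for every $p\colon E\to Y$ in $\mathcal{A}$ and $f\colon X\to Y$, with $F$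 the pullback of $f$ and $p$ and base changes $f^*p\colon F\to X$, $p^*f\colon F\to E$, there is $i\colon\mathrm{Map}_p(p^*f)\to\mathrm{Path}(f^*p)$ with $i\circ\langle\mathrm{id}_F,\mathrm{r}_p\,p^*f\rangle=\mathrm{r}_{f^*p}$ and $\partial_{f^*p}\circ i=\langle\mathrm{pm}_0,\langle(f^*p)\mathrm{pm}_0,\partial^1_p\mathrm{pm}_1\rangle\rangle$. -}

module Defs where

open import Data.Product using (Σ; Σ-syntax; _×_; _,_; proj₁; proj₂)
open import Data.Sum using (_⊎_; inj₁; inj₂)
open import Relation.Binary.PropositionalEquality using (_≡_; refl; subst)
open import Axiom.UniquenessOfIdentityProofs using (UIP)

record Groupoid : Set₁ where
  infixr 9 _∘_
  field
    Ob    : Set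
    Hom   : Ob → Ob → Set
    id    : ∀ {a} → Hom a a
    _∘_   : ∀ {a b c} → Hom b c → Hom a b → Hom a c
    _⁻¹   : ∀ {a b} → Hom a b → Hom b a
    idˡ   : ∀ {a b} (f : Hom a b) → id ∘ f ≡ f
    idʳ   : ∀ {a b} (f : Hom a b) → f ∘ id ≡ f
    assoc : ∀ {a b c d} (h : Hom c d) (g : Hom b c) (f : Hom a b) →
            (h ∘ g) ∘ f ≡ h ∘ (g ∘ f)
    invˡ  : ∀ {a b} (f : Hom a b) → (f ⁻¹) ∘ f ≡ id
    invʳ  : ∀ {a b} (f : Hom a b) → f ∘ (f ⁻¹) ≡ id
    Ob-set  : UIP Ob
    Hom-set : ∀ {a b} → UIP (Hom a b)

open Groupoid using (Ob; Hom)

idTo : (G : Groupoid) {a b : Ob G} → a ≡ b → Hom G a b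
idTo G refl = Groupoid.id G

record Functor (G H : Groupoid) : Set where
  private
    module G = Groupoid G
    module H = Groupoid H
  field
    F₀   : G.Ob → H.Ob
    F₁   : ∀ {a b} → G.Hom a b → H.Hom (F₀ a) (F₀ b)
    F-id : ∀ {a} → F₁ (G.id {a}) ≡ H.id
    F-∘  : ∀ {a b c} (g : G.Hom b c) (f : G.Hom a b) →
           F₁ (g G.∘ f) ≡ F₁ g H.∘ F₁ f

open Functor using (F₀; F₁)

Id : (G : Groupoid) → Functor G G
Id G = record { F₀ = λ x → x ; F₁ = λ f → f ; F-id = refl ; F-∘ = λ _ _ → refl }

infixr 9 _∘F_
_∘F_ : ∀ {G H K} → Functor H K → Functor G H → Functor G K
_∘F_ {G} {H} {K} F E = record
  { F₀ = λ x → F₀ F (F₀ E x)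
  ; F₁ = λ f → F₁ F (F₁ E f)
  ; F-id = trans' (congF (Functor.F-id E)) (Functor.F-id F)
  ; F-∘ = λ g f → trans' (congF (Functor.F-∘ E g f)) (Functor.F-∘ F (F₁ E g) (F₁ E f))
  }
  where
  trans' : ∀ {A : Set} {x y z : A} → x ≡ y → y ≡ z → x ≡ z
  trans' refl q = q
  congF : ∀ {a b} {u v : Hom H a b} → u ≡ v → F₁ F u ≡ F₁ F v
  congF refl = refl

-- Equality of functors (strict equality of functors, i.e. the equality
-- of arrows in the 1-category Gpd): equal on objects, and equal on
-- arrows up to the transport along the object equalities.
record _≈_ {G H : Groupoid} (F K : Functor G H) : Set where
  private
    module H = Groupoid H
  field
    ≈₀ : ∀ x → F₀ F x ≡ F₀ K x
    ≈₁ : ∀ {x y} (f : Hom G x y) →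
         F₁ K f H.∘ idTo H (≈₀ x) ≡ idTo H (≈₀ y) H.∘ F₁ F f

infix 4 _≈_

record IsTerminal (T : Groupoid) : Set₁ where
  field
    !        : (G : Groupoid) → Functor G T
    !-unique : ∀ {G} (F : Functor G T) → F ≈ ! G

record IsIso {G H : Groupoid} (F : Functor G H) : Set where
  field
    inv   : Functor H G
    inv-l : inv ∘F F ≈ Id G
    inv-r : F ∘F inv ≈ Id H

record IsPullback {X Y Z P : Groupoid} (f : Functor X Z) (g : Functor Y Z)
                  (π₁ : Functor P X) (π₂ : Functor P Y) : Set₁ where
  field
    comm   : f ∘F π₁ ≈ g ∘F π₂
    ⟨_,_⟩[_] : ∀ {W} (h : Functor W X) (k : Functor W Y) →
             f ∘F h ≈ g ∘F k → Functor W P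
    β₁     : ∀ {W} (h : Functor W X) (k : Functor W Y) (c : f ∘F h ≈ g ∘F k) →
             π₁ ∘F ⟨ h , k ⟩[ c ] ≈ h
    β₂     : ∀ {W} (h : Functor W X) (k : Functor W Y) (c : f ∘F h ≈ g ∘F k) →
             π₂ ∘F ⟨ h , k ⟩[ c ] ≈ k
    unique : ∀ {W} (h : Functor W X) (k : Functor W Y) (c : f ∘F h ≈ g ∘F k)
             (m : Functor W P) → π₁ ∘F m ≈ h → π₂ ∘F m ≈ k →
             m ≈ ⟨ h , k ⟩[ c ]

record Pullback {X Y Z : Groupoid} (f : Functor X Z) (g : Functor Y Z) : Set₁ where
  field
    P    : Groupoid
    π₁   : Functor P X
    π₂   : Functor P Y
    isPb : IsPullback f g π₁ π₂

LLP : ∀ {A B E Y : Groupoid} (i : Functor A B) (q : Functor E Y) → Set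
LLP {A} {B} {E} {Y} i q =
  (u : Functor A E) (v : Functor B Y) → q ∘F u ≈ v ∘F i →
  Σ[ d ∈ Functor B E ] ((d ∘F i ≈ u) × (q ∘F d ≈ v))

record Lift {E X : Groupoid} (p : Functor E X) (e : Ob E)
            {x : Ob X} (f : Hom X (F₀ p e) x) : Set where
  private
    module E = Groupoid E
    module X = Groupoid X
  field
    cod    : E.Ob
    cod-eq : F₀ p cod ≡ x
    arr    : E.Hom e cod
    arr-eq : idTo X cod-eq X.∘ F₁ p arr ≡ f

record NormalClovenFibration {E X : Groupoid} (p : Functor E X) : Set where
  private
    module E = Groupoid E
    module X = Groupoid X
  field
    lift   : (e : E.Ob) {x : X.Ob} (f : X.Hom (F₀ p e) x) → Lift p e f
    normal : (e : E.Ob) →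
             Σ[ r ∈ Lift.cod (lift e X.id) ≡ e ]
               subst (E.Hom e) r (Lift.arr (lift e X.id)) ≡ E.id

𝒢 : ∀ {E X : Groupoid} → Functor E X → Set
𝒢 p = NormalClovenFibration p

Class : Set₁
Class = ∀ {X Y : Groupoid} → Functor X Y → Set

record Tribe (𝒜 : Class) : Set₁ where
  field
    ⊤          : Groupoid
    ⊤-terminal : IsTerminal ⊤
    pb     : ∀ {X Y Z} (f : Functor X Z) (g : Functor Y Z) →
             𝒜 f ⊎ 𝒜 g → Pullback f g
    𝒜-∘    : ∀ {X Y Z} {g : Functor Y Z} {f : Functor X Y} →
             𝒜 g → 𝒜 f → 𝒜 (g ∘F f)
    𝒜-bc   : ∀ {X E Y P} (f : Functor X Y) (p : Functor E Y)
             (π₁ : Functor P X) (π₂ : Functor P E) →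
             IsPullback f p π₁ π₂ → 𝒜 p → 𝒜 π₁
    𝒜-iso  : ∀ {X Y} (f : Functor X Y) → IsIso f → 𝒜 f
    𝒜-term : ∀ {X T} → IsTerminal T → (f : Functor X T) → 𝒜 f

module _ {𝒜 : Class} (T : Tribe 𝒜) where
  open Tribe T

  pbSelf : ∀ {E Y} (p : Functor E Y) → 𝒜 p → Pullback p p
  pbSelf p a = pb p p (inj₂ a)

  IsDiagonal : ∀ {E Y} (p : Functor E Y) (a : 𝒜 p) →
               Functor E (Pullback.P (pbSelf p a)) → Set
  IsDiagonal {E} p a δ =
    (Pullback.π₁ (pbSelf p a) ∘F δ ≈ Id E) × (Pullback.π₂ (pbSelf p a) ∘F δ ≈ Id E)

  record PathObject {E Y : Groupoid} (p : Functor E Y) (a : 𝒜 p) : Set₁ where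
    field
      Path  : Groupoid
      r     : Functor E Path
      ∂     : Functor Path (Pullback.P (pbSelf p a))
      fact  : IsDiagonal p a (∂ ∘F r)
      ∂∈𝒜   : 𝒜 ∂
      r-llp : ∀ {Z W} (q : Functor Z Path) → 𝒜 q →
              (π₁ : Functor W Z) (π₂ : Functor W E) → IsPullback q r π₁ π₂ →
              ∀ {S U} (g : Functor S U) → 𝒜 g → LLP π₁ g

  PathObjects : Set₁
  PathObjects = ∀ {E Y} (p : Functor E Y) (a : 𝒜 p) → PathObject p a

  module _ (PO : PathObjects) where

    ∂⁰ ∂¹ : ∀ {E Y} (p : Functor E Y) (a : 𝒜 p) →
            Functor (PathObject.Path (PO p a)) E
    ∂⁰ p a = Pullback.π₁ (pbSelf p a) ∘F PathObject.∂ (PO p a)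
    ∂¹ p a = Pullback.π₂ (pbSelf p a) ∘F PathObject.∂ (PO p a)

    -- ∂⁰ is in 𝒜 (composite of ∂ with a base change of p)
    ∂⁰∈𝒜 : ∀ {E Y} (p : Functor E Y) (a : 𝒜 p) → 𝒜 (∂⁰ p a)
    ∂⁰∈𝒜 p a = 𝒜-∘ (𝒜-bc p p (Pullback.π₁ (pbSelf p a)) (Pullback.π₂ (pbSelf p a))
                         (Pullback.isPb (pbSelf p a)) a)
                    (PathObject.∂∈𝒜 (PO p a))

    Map : ∀ {E Y X} (p : Functor E Y) (a : 𝒜 p) (g : Functor X E) →
          Pullback g (∂⁰ p a)
    Map p a g = pb g (∂⁰ p a) (inj₂ (∂⁰∈𝒜 p a))

    StablePathObjects : Set₁
    StablePathObjects =
      ∀ {E Y X} (p : Functor E Y) (a : 𝒜 p) (f : Functor X Y) →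
      let F    = pb f p (inj₂ a)
          FG   = Pullback.P F
          f*p  = Pullback.π₁ F
          p*f  = Pullback.π₂ F
          a'   = 𝒜-bc f p f*p p*f (Pullback.isPb F) a
          M    = Map p a p*f
          pm₀  = Pullback.π₁ M
          pm₁  = Pullback.π₂ M
          FF   = pbSelf f*p a'
          Pq   = PO f*p a'
          Pp   = PO p a
      in Σ[ i ∈ Functor (Pullback.P M) (PathObject.Path Pq) ]
           -- i ∘ ⟨ id_F , r_p ∘ p*f ⟩ = r_{f*p}
           ((∀ (m : Functor FG (Pullback.P M)) →
               pm₀ ∘F m ≈ Id FG → pm₁ ∘F m ≈ PathObject.r Pp ∘F p*f →
               i ∘F m ≈ PathObject.r Pq)
           -- ∂_{f*p} ∘ i = ⟨ pm₀ , ⟨ f*p ∘ pm₀ , ∂¹_p ∘ pm₁ ⟩ ⟩ (componentwise)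
           × (Pullback.π₁ FF ∘F PathObject.∂ Pq ∘F i ≈ pm₀)
           × (f*p ∘F Pullback.π₂ FF ∘F PathObject.∂ Pq ∘F i ≈ f*p ∘F pm₀)
           × (p*f ∘F Pullback.π₂ FF ∘F PathObject.∂ Pq ∘F i ≈ ∂¹ p a ∘F pm₁))

{-# OPTIONS --safe --with-K #-}
-- Pullbacks in Gpd are computed strictly (pairs of objects with an equality of
-- their images), and normal cloven fibrations are closed under composition,
-- isomorphisms, maps to a terminal groupoid and strict base change; as every
-- pullback square is isomorphic to the strict one, this gives the tribe.
-- Path(p) is the groupoid of vertical isomorphisms u : e₀ ≅ e₁ (p u an
-- identity), with r e = id and ∂ u = (e₀, e₁); ∂ is a fibration since u can be
-- conjugated along any arrow of E ×_p E. The map r is a strong deformation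
-- retract (retraction u ↦ e₀, and the natural isomorphism u ↦ id_e₀ is trivial
-- on the image of r). Strong deformation retracts are stable under base change
-- along fibrations and lift against fibrations: a filler is obtained by
-- transporting along chosen lifts, and normality makes these lifts trivial on
-- the image. For stability, a path of p starting at the image of a point of the
-- pullback extends to a path of f*p that is constant in X.
module Submission where

open import Defs
open import Data.Product using (Σ; Σ-syntax; _×_; _,_; proj₁; proj₂)
open import Data.Unit using (⊤; tt)
open import Relation.Binary.PropositionalEquality
  using (_≡_; refl; sym; trans; cong; cong₂; subst; module ≡-Reasoning)
open import Axiom.UniquenessOfIdentityProofs.WithK using (uip)
open Functor using (F₀; F₁)
open _≈_

module GroupoidProperties (G : Groupoid) where
  open Groupoid G
  open ≡-Reasoning

  private variable
    a b c a′ b′ c′ a″ b″ : Ob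

  conj : Hom a a′ → Hom b b′ → Hom a b → Hom a′ b′
  conj x y h = y ∘ (h ∘ x ⁻¹)

  -- Opaque, so that comparing functors whose laws are proved with these lemmas
  -- never unfolds the proofs (which makes type checking very slow).
  opaque
    cancelʳ : (f : Hom a b) (g : Hom b c) → (g ∘ f) ∘ f ⁻¹ ≡ g
    cancelʳ f g = trans (assoc _ _ _) (trans (cong (g ∘_) (invʳ f)) (idʳ g))

    cancel⁻¹ʳ : (f : Hom b a) (g : Hom b c) → (g ∘ f ⁻¹) ∘ f ≡ g
    cancel⁻¹ʳ f g = trans (assoc _ _ _) (trans (cong (g ∘_) (invˡ f)) (idʳ g))

    ⁻¹-unique : {f : Hom a b} {g : Hom b a} → g ∘ f ≡ id → g ≡ f ⁻¹
    ⁻¹-unique {f = f} {g} gf≡id = begin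
      g                ≡⟨ cancelʳ f g ⟨
      (g ∘ f) ∘ f ⁻¹   ≡⟨ cong (_∘ f ⁻¹) gf≡id ⟩
      id ∘ f ⁻¹        ≡⟨ idˡ _ ⟩
      f ⁻¹             ∎

    ⁻¹-id : id {a} ⁻¹ ≡ id
    ⁻¹-id = sym (⁻¹-unique (idˡ id))

    idTo-trans : (p : a ≡ b) (q : b ≡ c) → idTo G (trans p q) ≡ idTo G q ∘ idTo G p
    idTo-trans refl q = sym (idʳ _)

    idTo-sym : (p : a ≡ b) → idTo G (sym p) ≡ idTo G p ⁻¹
    idTo-sym refl = sym ⁻¹-id

    idTo-∘ : (p : a ≡ b) (q : b ≡ c) (r : a ≡ c) → idTo G q ∘ idTo G p ≡ idTo G r
    idTo-∘ p q r = trans (sym (idTo-trans p q)) (cong (idTo G) (uip (trans p q) r))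

    idTo-loop : (p : a ≡ a) → idTo G p ≡ id
    idTo-loop p = cong (idTo G) (uip p refl)

    id-square : (f : Hom a b) → f ∘ id ≡ id ∘ f
    id-square f = trans (idʳ f) (sym (idˡ f))

    idTo-square-sym : (p : a ≡ a′) (q : b ≡ b′) {f : Hom a b} {k : Hom a′ b′} →
                      k ∘ idTo G p ≡ idTo G q ∘ f → f ∘ idTo G (sym p) ≡ idTo G (sym q) ∘ k
    idTo-square-sym refl refl {f} {k} s = trans (idʳ f) (trans (sym k≡f) (sym (idˡ k)))
      where
      k≡f : k ≡ f
      k≡f = trans (sym (idʳ k)) (trans s (idˡ f))

    idTo-square-trans : (p : a ≡ a′) (q : b ≡ b′) (p′ : a′ ≡ a″) (q′ : b′ ≡ b″)
                        {f : Hom a b} {k : Hom a′ b′} {l : Hom a″ b″} →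
                        k ∘ idTo G p ≡ idTo G q ∘ f → l ∘ idTo G p′ ≡ idTo G q′ ∘ k →
                        l ∘ idTo G (trans p p′) ≡ idTo G (trans q q′) ∘ f
    idTo-square-trans refl refl refl refl {k = k} s t = trans t (trans (idˡ k) (trans (sym (idʳ k)) s))

    idTo-moveˡ : (p : a ≡ b) {g : Hom c a} {h : Hom c b} → idTo G p ∘ g ≡ h → g ≡ idTo G (sym p) ∘ h
    idTo-moveˡ refl {g} {h} g≡h = trans (sym (idˡ g)) (trans g≡h (sym (idˡ h)))

    square⇒conj : {x : Hom a a′} {y : Hom b b′} {h : Hom a b} {k : Hom a′ b′} →
                  k ∘ x ≡ y ∘ h → k ≡ conj x y h
    square⇒conj {x = x} {y} {h} {k} kx≡yh = begin
      k                ≡⟨ cancelʳ x k ⟨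
      (k ∘ x) ∘ x ⁻¹   ≡⟨ cong (_∘ x ⁻¹) kx≡yh ⟩
      (y ∘ h) ∘ x ⁻¹   ≡⟨ assoc _ _ _ ⟩
      conj x y h       ∎

    conj-square : (x : Hom a a′) (y : Hom b b′) (h : Hom a b) → conj x y h ∘ x ≡ y ∘ h
    conj-square x y h = trans (assoc _ _ _) (cong (y ∘_) (cancel⁻¹ʳ x h))

    conj⇒square : {x : Hom a a′} {y : Hom b b′} {h : Hom a b} {k : Hom a′ b′} →
                  k ≡ conj x y h → k ∘ x ≡ y ∘ h
    conj⇒square refl = conj-square _ _ _

    conj-cong : {x x′ : Hom a a′} {y y′ : Hom b b′} {h h′ : Hom a b} →
                x ≡ x′ → y ≡ y′ → h ≡ h′ → conj x y h ≡ conj x′ y′ h′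
    conj-cong refl refl refl = refl

    conj-id : (x : Hom a b) → conj x x id ≡ id
    conj-id x = trans (cong (x ∘_) (idˡ _)) (invʳ x)

    conj-idid : (h : Hom a b) → conj id id h ≡ h
    conj-idid h = sym (square⇒conj (id-square h))

    conj-∘ : (x : Hom a a′) (y : Hom b b′) (z : Hom c c′) (g : Hom b c) (f : Hom a b) →
             conj y z g ∘ conj x y f ≡ conj x z (g ∘ f)
    conj-∘ x y z g f = square⇒conj (begin
      (conj y z g ∘ conj x y f) ∘ x ≡⟨ assoc _ _ _ ⟩
      conj y z g ∘ (conj x y f ∘ x) ≡⟨ cong (conj y z g ∘_) (conj-square x y f) ⟩
      conj y z g ∘ (y ∘ f)          ≡⟨ assoc _ _ _ ⟨
      (conj y z g ∘ y) ∘ f          ≡⟨ cong (_∘ f) (conj-square y z g) ⟩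
      (z ∘ g) ∘ f                   ≡⟨ assoc _ _ _ ⟩
      z ∘ (g ∘ f)                   ∎)

    conj-conj : (x : Hom a a′) (y : Hom b b′) (x′ : Hom a′ a″) (y′ : Hom b′ b″) (h : Hom a b) →
                conj x′ y′ (conj x y h) ≡ conj (x′ ∘ x) (y′ ∘ y) h
    conj-conj x y x′ y′ h = square⇒conj (begin
      conj x′ y′ (conj x y h) ∘ (x′ ∘ x) ≡⟨ assoc _ _ _ ⟨
      (conj x′ y′ (conj x y h) ∘ x′) ∘ x ≡⟨ cong (_∘ x) (conj-square x′ y′ _) ⟩
      (y′ ∘ conj x y h) ∘ x              ≡⟨ assoc _ _ _ ⟩
      y′ ∘ (conj x y h ∘ x)              ≡⟨ cong (y′ ∘_) (conj-square x y h) ⟩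
      y′ ∘ (y ∘ h)                       ≡⟨ assoc _ _ _ ⟨
      (y′ ∘ y) ∘ h                       ∎)

    conj-⁻¹ : (x : Hom a a′) (y : Hom b b′) (h : Hom a b) → conj x y h ⁻¹ ≡ conj y x (h ⁻¹)
    conj-⁻¹ x y h = sym (⁻¹-unique (trans (conj-∘ x y x (h ⁻¹) h)
                                          (trans (conj-cong refl refl (invˡ h)) (conj-id x))))

    conj-idTo-id : (p : a ≡ c) (q : b ≡ c) → conj (idTo G (sym p)) (idTo G (sym q)) id ≡ idTo G (trans p (sym q))
    conj-idTo-id refl refl = conj-id id

    conj-idTo-conj : (p : a ≡ a′) (q : b ≡ b′) (p′ : a′ ≡ a″) (q′ : b′ ≡ b″)
                     (p″ : a ≡ a″) (q″ : b ≡ b″) (h : Hom a b) →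
                     conj (idTo G p′) (idTo G q′) (conj (idTo G p) (idTo G q) h) ≡ conj (idTo G p″) (idTo G q″) h
    conj-idTo-conj refl refl p′ q′ p″ q″ h =
      conj-cong (cong (idTo G) (uip p′ p″)) (cong (idTo G) (uip q′ q″)) (conj-idid h)

    conj-cancel : (x : Hom a a′) (y : Hom b b′) (h : Hom a b) → conj (x ⁻¹) (y ⁻¹) (conj x y h) ≡ h
    conj-cancel x y h = trans (conj-conj x y (x ⁻¹) (y ⁻¹) h)
                              (trans (conj-cong (invˡ x) (invˡ y) refl) (conj-idid h))

module FunctorProperties {G H : Groupoid} (F : Functor G H) where
  private
    module G = Groupoid G
    module H = Groupoid H
  open Functor F using (F-id; F-∘)

  opaque
    F-⁻¹ : ∀ {a b} (f : G.Hom a b) → F₁ F (f G.⁻¹) ≡ F₁ F f H.⁻¹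
    F-⁻¹ f = GroupoidProperties.⁻¹-unique H (trans (sym (F-∘ _ _)) (trans (cong (F₁ F) (G.invˡ f)) F-id))

    F-idTo : ∀ {a b} (p : a ≡ b) → F₁ F (idTo G p) ≡ idTo H (cong (F₀ F) p)
    F-idTo refl = F-id

    F-conj : ∀ {a a′ b b′} (x : G.Hom a a′) (y : G.Hom b b′) (h : G.Hom a b) →
             F₁ F (GroupoidProperties.conj G x y h) ≡ GroupoidProperties.conj H (F₁ F x) (F₁ F y) (F₁ F h)
    F-conj x y h = trans (F-∘ _ _) (cong (F₁ F y H.∘_) (trans (F-∘ _ _) (cong (F₁ F h H.∘_) (F-⁻¹ x))))

    F-square : ∀ {a a′ b b′} (p : a ≡ a′) (q : b ≡ b′) {f : G.Hom a b} {k : G.Hom a′ b′} →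
               k G.∘ idTo G p ≡ idTo G q G.∘ f →
               F₁ F k H.∘ idTo H (cong (F₀ F) p) ≡ idTo H (cong (F₀ F) q) H.∘ F₁ F f
    F-square refl refl {f} {k} s =
      trans (cong (F₁ F k H.∘_) (sym F-id))
        (trans (sym (F-∘ _ _)) (trans (cong (F₁ F) s) (trans (F-∘ _ _) (cong (H._∘ F₁ F f) F-id))))

module _ {G H : Groupoid} where
  private
    module H = Groupoid H
    open module GPH = GroupoidProperties H using (conj)

  ≈-sym : {F K : Functor G H} → F ≈ K → K ≈ F
  ≈-sym e = record
    { ≈₀ = λ x → sym (≈₀ e x)
    ; ≈₁ = λ f → GPH.idTo-square-sym (≈₀ e _) (≈₀ e _) (≈₁ e f) }

  ≈-trans : {F K L : Functor G H} → F ≈ K → K ≈ L → F ≈ L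
  ≈-trans e e′ = record
    { ≈₀ = λ x → trans (≈₀ e x) (≈₀ e′ x)
    ; ≈₁ = λ f → GPH.idTo-square-trans (≈₀ e _) (≈₀ e _) (≈₀ e′ _) (≈₀ e′ _) (≈₁ e f) (≈₁ e′ f) }

  conj⇒≈ : {F K : Functor G H} (e : ∀ x → F₀ F x ≡ F₀ K x) →
           (∀ {x y} (f : Groupoid.Hom G x y) → F₁ K f ≡ conj (idTo H (e x)) (idTo H (e y)) (F₁ F f)) →
           F ≈ K
  conj⇒≈ e e₁ = record { ≈₀ = e ; ≈₁ = λ f → GPH.conj⇒square (e₁ f) }

  ≈⇒conj : {F K : Functor G H} (e : F ≈ K) → ∀ {x y} (f : Groupoid.Hom G x y) →
           F₁ K f ≡ conj (idTo H (≈₀ e x)) (idTo H (≈₀ e y)) (F₁ F f)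
  ≈⇒conj e f = GPH.square⇒conj (≈₁ e f)

module _ {G H K L : Groupoid} where
  ∘F-assoc : (A : Functor K L) (B : Functor H K) (C : Functor G H) → (A ∘F B) ∘F C ≈ A ∘F (B ∘F C)
  ∘F-assoc _ _ _ = record { ≈₀ = λ _ → refl ; ≈₁ = λ _ → GroupoidProperties.id-square L _ }

module _ {G H : Groupoid} where
  ∘F-identityʳ : (F : Functor G H) → F ∘F Id G ≈ F
  ∘F-identityʳ F = record { ≈₀ = λ _ → refl ; ≈₁ = λ _ → GroupoidProperties.id-square H _ }

module _ {G H K : Groupoid} where
  ∘F-congˡ : (L : Functor H K) {F F′ : Functor G H} → F ≈ F′ → L ∘F F ≈ L ∘F F′
  ∘F-congˡ L e = record
    { ≈₀ = λ x → cong (F₀ L) (≈₀ e x)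
    ; ≈₁ = λ f → FunctorProperties.F-square L (≈₀ e _) (≈₀ e _) (≈₁ e f) }

  ∘F-congʳ : {L L′ : Functor H K} (F : Functor G H) → L ≈ L′ → L ∘F F ≈ L′ ∘F F
  ∘F-congʳ F e = record { ≈₀ = λ x → ≈₀ e (F₀ F x) ; ≈₁ = λ f → ≈₁ e (F₁ F f) }

conjugate : ∀ {G H} (F : Functor G H) {K₀ : Groupoid.Ob G → Groupoid.Ob H} →
            (∀ x → Groupoid.Hom H (F₀ F x) (K₀ x)) → Functor G H
conjugate {G} {H} F {K₀} θ = record
  { F₀ = K₀
  ; F₁ = λ {x} {y} f → conj (θ x) (θ y) (F₁ F f)
  ; F-id = λ {x} → trans (conj-cong refl refl (Functor.F-id F)) (conj-id (θ x))
  ; F-∘ = λ {x} {y} {z} g f →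
      trans (conj-cong refl refl (Functor.F-∘ F g f)) (sym (conj-∘ (θ x) (θ y) (θ z) _ _)) }
  where open GroupoidProperties H

𝟙 : Groupoid
𝟙 = record
  { Ob = ⊤ ; Hom = λ _ _ → ⊤ ; id = tt ; _∘_ = λ _ _ → tt ; _⁻¹ = λ _ → tt
  ; idˡ = λ _ → refl ; idʳ = λ _ → refl ; assoc = λ _ _ _ → refl
  ; invˡ = λ _ → refl ; invʳ = λ _ → refl ; Ob-set = uip ; Hom-set = uip }

𝟙-terminal : IsTerminal 𝟙
𝟙-terminal = record
  { ! = λ G → record { F₀ = λ _ → tt ; F₁ = λ _ → tt ; F-id = refl ; F-∘ = λ _ _ → refl }
  ; !-unique = λ F → record { ≈₀ = λ _ → refl ; ≈₁ = λ _ → refl } }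

module StrictPullback {X Y Z : Groupoid} (f : Functor X Z) (g : Functor Y Z) where
  private
    module X = Groupoid X
    module Y = Groupoid Y
    module Z = Groupoid Z
    module GPX = GroupoidProperties X
    module GPY = GroupoidProperties Y
    module GPZ = GroupoidProperties Z

  record Object : Set where
    constructor object
    field
      ob₁  : X.Ob
      ob₂  : Y.Ob
      glue : F₀ f ob₁ ≡ F₀ g ob₂
  open Object public

  record Arrow (s t : Object) : Set where
    constructor arrow
    field
      ar₁    : X.Hom (ob₁ s) (ob₁ t)
      ar₂    : Y.Hom (ob₂ s) (ob₂ t)
      square : F₁ g ar₂ Z.∘ idTo Z (glue s) ≡ idTo Z (glue t) Z.∘ F₁ f ar₁
  open Arrow public

  opaque
    Object-≡ : ∀ {s t} → ob₁ s ≡ ob₁ t → ob₂ s ≡ ob₂ t → s ≡ t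
    Object-≡ {object x y c} {object .x .y c′} refl refl = cong (object x y) (uip c c′)

    Arrow-≡ : ∀ {s t} {h k : Arrow s t} → ar₁ h ≡ ar₁ k → ar₂ h ≡ ar₂ k → h ≡ k
    Arrow-≡ {h = arrow a b sq} {arrow .a .b sq′} refl refl = cong (arrow a b) (uip sq sq′)

    id-commutes : ∀ {s} → F₁ g Y.id Z.∘ idTo Z (glue s) ≡ idTo Z (glue s) Z.∘ F₁ f X.id
    id-commutes {s} = begin
      F₁ g Y.id Z.∘ idTo Z (glue s) ≡⟨ cong (Z._∘ idTo Z (glue s)) (Functor.F-id g) ⟩
      Z.id Z.∘ idTo Z (glue s)      ≡⟨ GPZ.id-square _ ⟨
      idTo Z (glue s) Z.∘ Z.id      ≡⟨ cong (idTo Z (glue s) Z.∘_) (Functor.F-id f) ⟨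
      idTo Z (glue s) Z.∘ F₁ f X.id ∎
      where open ≡-Reasoning

    ∘-commutes : ∀ {s t u} (k : Arrow t u) (h : Arrow s t) →
                 F₁ g (ar₂ k Y.∘ ar₂ h) Z.∘ idTo Z (glue s) ≡ idTo Z (glue u) Z.∘ F₁ f (ar₁ k X.∘ ar₁ h)
    ∘-commutes {s} {t} {u} (arrow a′ b′ sq′) (arrow a b sq) = begin
      F₁ g (b′ Y.∘ b) Z.∘ idTo Z (glue s)       ≡⟨ cong (Z._∘ idTo Z (glue s)) (Functor.F-∘ g b′ b) ⟩
      (F₁ g b′ Z.∘ F₁ g b) Z.∘ idTo Z (glue s)  ≡⟨ Z.assoc _ _ _ ⟩
      F₁ g b′ Z.∘ (F₁ g b Z.∘ idTo Z (glue s))  ≡⟨ cong (F₁ g b′ Z.∘_) sq ⟩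
      F₁ g b′ Z.∘ (idTo Z (glue t) Z.∘ F₁ f a)  ≡⟨ Z.assoc _ _ _ ⟨
      (F₁ g b′ Z.∘ idTo Z (glue t)) Z.∘ F₁ f a  ≡⟨ cong (Z._∘ F₁ f a) sq′ ⟩
      (idTo Z (glue u) Z.∘ F₁ f a′) Z.∘ F₁ f a  ≡⟨ Z.assoc _ _ _ ⟩
      idTo Z (glue u) Z.∘ (F₁ f a′ Z.∘ F₁ f a)  ≡⟨ cong (idTo Z (glue u) Z.∘_) (Functor.F-∘ f a′ a) ⟨
      idTo Z (glue u) Z.∘ F₁ f (a′ X.∘ a)       ∎
      where open ≡-Reasoning

    ⁻¹-commutes : ∀ {s t} (h : Arrow s t) →
                  F₁ g (ar₂ h Y.⁻¹) Z.∘ idTo Z (glue t) ≡ idTo Z (glue s) Z.∘ F₁ f (ar₁ h X.⁻¹)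
    ⁻¹-commutes {s} {t} (arrow a b sq) = GPZ.conj⇒square (begin
      F₁ g (b Y.⁻¹)                                                ≡⟨ FunctorProperties.F-⁻¹ g b ⟩
      F₁ g b Z.⁻¹                                                  ≡⟨ cong Z._⁻¹ (GPZ.square⇒conj sq) ⟩
      GPZ.conj (idTo Z (glue s)) (idTo Z (glue t)) (F₁ f a) Z.⁻¹   ≡⟨ GPZ.conj-⁻¹ _ _ _ ⟩
      GPZ.conj (idTo Z (glue t)) (idTo Z (glue s)) (F₁ f a Z.⁻¹)   ≡⟨ cong (GPZ.conj _ _) (FunctorProperties.F-⁻¹ f a) ⟨
      GPZ.conj (idTo Z (glue t)) (idTo Z (glue s)) (F₁ f (a X.⁻¹)) ∎)
      where open ≡-Reasoning

  P : Groupoid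
  P = record
    { Ob = Object ; Hom = Arrow
    ; id = λ {s} → arrow X.id Y.id (id-commutes {s})
    ; _∘_ = λ k h → arrow (ar₁ k X.∘ ar₁ h) (ar₂ k Y.∘ ar₂ h) (∘-commutes k h)
    ; _⁻¹ = λ h → arrow (ar₁ h X.⁻¹) (ar₂ h Y.⁻¹) (⁻¹-commutes h)
    ; idˡ = λ _ → Arrow-≡ (X.idˡ _) (Y.idˡ _)
    ; idʳ = λ _ → Arrow-≡ (X.idʳ _) (Y.idʳ _)
    ; assoc = λ _ _ _ → Arrow-≡ (X.assoc _ _ _) (Y.assoc _ _ _)
    ; invˡ = λ _ → Arrow-≡ (X.invˡ _) (Y.invˡ _)
    ; invʳ = λ _ → Arrow-≡ (X.invʳ _) (Y.invʳ _)
    ; Ob-set = uip ; Hom-set = uip }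

  ar₁-idTo : ∀ {s t} (e : s ≡ t) (p : ob₁ s ≡ ob₁ t) → ar₁ (idTo P e) ≡ idTo X p
  ar₁-idTo refl p = sym (GPX.idTo-loop p)

  ar₂-idTo : ∀ {s t} (e : s ≡ t) (p : ob₂ s ≡ ob₂ t) → ar₂ (idTo P e) ≡ idTo Y p
  ar₂-idTo refl p = sym (GPY.idTo-loop p)

  π₁ : Functor P X
  π₁ = record { F₀ = ob₁ ; F₁ = ar₁ ; F-id = refl ; F-∘ = λ _ _ → refl }

  π₂ : Functor P Y
  π₂ = record { F₀ = ob₂ ; F₁ = ar₂ ; F-id = refl ; F-∘ = λ _ _ → refl }

  commutes : f ∘F π₁ ≈ g ∘F π₂
  commutes = record { ≈₀ = glue ; ≈₁ = square }

  pair : ∀ {W} (h : Functor W X) (k : Functor W Y) → f ∘F h ≈ g ∘F k → Functor W P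
  pair h k c = record
    { F₀ = λ w → object (F₀ h w) (F₀ k w) (≈₀ c w)
    ; F₁ = λ a → arrow (F₁ h a) (F₁ k a) (≈₁ c a)
    ; F-id = Arrow-≡ (Functor.F-id h) (Functor.F-id k)
    ; F-∘ = λ a b → Arrow-≡ (Functor.F-∘ h a b) (Functor.F-∘ k a b) }

  pair-unique : ∀ {W} (h : Functor W X) (k : Functor W Y) (c : f ∘F h ≈ g ∘F k)
                (m : Functor W P) → π₁ ∘F m ≈ h → π₂ ∘F m ≈ k → m ≈ pair h k c
  pair-unique h k c m α β = record
    { ≈₀ = e
    ; ≈₁ = λ a → Arrow-≡
        (trans (cong (F₁ h a X.∘_) (ar₁-idTo (e _) (≈₀ α _)))
          (trans (≈₁ α a) (cong (X._∘ _) (sym (ar₁-idTo (e _) (≈₀ α _))))))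
        (trans (cong (F₁ k a Y.∘_) (ar₂-idTo (e _) (≈₀ β _)))
          (trans (≈₁ β a) (cong (Y._∘ _) (sym (ar₂-idTo (e _) (≈₀ β _)))))) }
    where
    e : ∀ w → F₀ m w ≡ object (F₀ h w) (F₀ k w) (≈₀ c w)
    e w = Object-≡ (≈₀ α w) (≈₀ β w)

  isPullback : IsPullback f g π₁ π₂
  isPullback = record
    { comm = commutes
    ; ⟨_,_⟩[_] = pair
    ; β₁ = λ _ _ _ → record { ≈₀ = λ _ → refl ; ≈₁ = λ _ → GPX.id-square _ }
    ; β₂ = λ _ _ _ → record { ≈₀ = λ _ → refl ; ≈₁ = λ _ → GPY.id-square _ }
    ; unique = pair-unique }

  pullback : Pullback f g
  pullback = record { P = P ; π₁ = π₁ ; π₂ = π₂ ; isPb = isPullback }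

module PullbackComparison {X Y Z P : Groupoid} {f : Functor X Z} {g : Functor Y Z}
                          {π₁ : Functor P X} {π₂ : Functor P Y} (pb : IsPullback f g π₁ π₂) where
  open IsPullback pb
  private
    module S = StrictPullback f g

  to : Functor P S.P
  to = S.pair π₁ π₂ comm

  from : Functor S.P P
  from = ⟨ S.π₁ , S.π₂ ⟩[ S.commutes ]

  π₁-to : S.π₁ ∘F to ≈ π₁
  π₁-to = record { ≈₀ = λ _ → refl ; ≈₁ = λ _ → GroupoidProperties.id-square X _ }

  π₂-to : S.π₂ ∘F to ≈ π₂
  π₂-to = record { ≈₀ = λ _ → refl ; ≈₁ = λ _ → GroupoidProperties.id-square Y _ }

  to∘from : to ∘F from ≈ Id S.P
  to∘from = ≈-trans
    (S.pair-unique S.π₁ S.π₂ S.commutes (to ∘F from)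
      (≈-trans (≈-sym (∘F-assoc S.π₁ to from)) (≈-trans (∘F-congʳ from π₁-to) (β₁ S.π₁ S.π₂ S.commutes)))
      (≈-trans (≈-sym (∘F-assoc S.π₂ to from)) (≈-trans (∘F-congʳ from π₂-to) (β₂ S.π₁ S.π₂ S.commutes))))
    (≈-sym (S.pair-unique S.π₁ S.π₂ S.commutes (Id S.P) (∘F-identityʳ S.π₁) (∘F-identityʳ S.π₂)))

  from∘to : from ∘F to ≈ Id P
  from∘to = ≈-trans
    (unique π₁ π₂ comm (from ∘F to)
      (≈-trans (≈-sym (∘F-assoc π₁ from to)) (≈-trans (∘F-congʳ to (β₁ S.π₁ S.π₂ S.commutes)) π₁-to))
      (≈-trans (≈-sym (∘F-assoc π₂ from to)) (≈-trans (∘F-congʳ to (β₂ S.π₁ S.π₂ S.commutes)) π₂-to)))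
    (≈-sym (unique π₁ π₂ comm (Id P) (∘F-identityʳ π₁) (∘F-identityʳ π₂)))

  to-iso : IsIso to
  to-iso = record { inv = from ; inv-l = from∘to ; inv-r = to∘from }

  LLP-transfer : ∀ {S U} (h : Functor S U) → LLP S.π₁ h → LLP π₁ h
  LLP-transfer h llp u v γ = d , d∘π₁≈u , proj₂ (proj₂ solution)
    where
    γ′ : h ∘F (u ∘F from) ≈ v ∘F S.π₁
    γ′ = ≈-trans (≈-sym (∘F-assoc h u from))
           (≈-trans (∘F-congʳ from γ)
             (≈-trans (∘F-assoc v π₁ from) (∘F-congˡ v (β₁ S.π₁ S.π₂ S.commutes))))
    solution = llp (u ∘F from) v γ′
    d = proj₁ solution
    d∘π₁≈u : d ∘F π₁ ≈ u
    d∘π₁≈u = ≈-trans (∘F-congˡ d (≈-sym π₁-to))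
               (≈-trans (≈-sym (∘F-assoc d S.π₁ to))
                 (≈-trans (∘F-congʳ to (proj₁ (proj₂ solution)))
                   (≈-trans (∘F-assoc u from to)
                     (≈-trans (∘F-congˡ u from∘to) (∘F-identityʳ u)))))

IsTrivialLift : ∀ {E X} {p : Functor E X} {e} {x} {f : Groupoid.Hom X (F₀ p e) x} → Lift p e f → Set
IsTrivialLift {E} {e = e} L = Σ[ ρ ∈ Lift.cod L ≡ e ] Lift.arr L ≡ idTo E (sym ρ)

mk𝒢 : ∀ {E X} {p : Functor E X} (lift : ∀ e {x} (f : Groupoid.Hom X (F₀ p e) x) → Lift p e f) →
      (∀ e → IsTrivialLift (lift e (Groupoid.id X))) → 𝒢 p
mk𝒢 {E} lift trivial = record
  { lift = lift
  ; normal = λ e → proj₁ (trivial e) , subst-id (proj₁ (trivial e)) (proj₂ (trivial e)) }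
  where
  open Groupoid E
  subst-id : ∀ {e c} (ρ : c ≡ e) {a : Hom e c} → a ≡ idTo E (sym ρ) → subst (Hom e) ρ a ≡ id
  subst-id refl a≡id = a≡id

module _ {E X : Groupoid} {p : Functor E X} (fib : 𝒢 p) where
  open NormalClovenFibration fib
  private
    module E = Groupoid E

  lift-idTo : ∀ e {x} (s : F₀ p e ≡ x) {k : Groupoid.Hom X (F₀ p e) x} → k ≡ idTo X s →
              IsTrivialLift (lift e k)
  lift-idTo e refl refl = proj₁ (normal e) , idTo-of-subst-id (proj₁ (normal e)) (proj₂ (normal e))
    where
    idTo-of-subst-id : ∀ {c} (ρ : c ≡ e) {a : E.Hom e c} → subst (E.Hom e) ρ a ≡ E.id → a ≡ idTo E (sym ρ)
    idTo-of-subst-id refl a≡id = a≡id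

𝒢-resp-≈ : ∀ {E X} {F K : Functor E X} → F ≈ K → 𝒢 F → 𝒢 K
𝒢-resp-≈ {E} {X} {F} {K} F≈K fib = mk𝒢 lift′ trivial
  where
  module X = Groupoid X
  module GPX = GroupoidProperties X
  open NormalClovenFibration fib
  lift′ : ∀ e {x} (k : X.Hom (F₀ K e) x) → Lift K e k
  lift′ e k = record { cod = c ; cod-eq = δ ; arr = a ; arr-eq = arr-eq }
    where
    ε : ∀ x → X.Hom (F₀ F x) (F₀ K x)
    ε x = idTo X (≈₀ F≈K x)
    L = lift e (k X.∘ ε e)
    c = Lift.cod L
    a = Lift.arr L
    δ = trans (sym (≈₀ F≈K c)) (Lift.cod-eq L)
    open ≡-Reasoning
    arr-eq : idTo X δ X.∘ F₁ K a ≡ k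
    arr-eq = begin
      idTo X δ X.∘ F₁ K a
        ≡⟨ cong (idTo X δ X.∘_) (≈⇒conj F≈K a) ⟩
      idTo X δ X.∘ (ε c X.∘ (F₁ F a X.∘ ε e X.⁻¹))
        ≡⟨ X.assoc _ _ _ ⟨
      (idTo X δ X.∘ ε c) X.∘ (F₁ F a X.∘ ε e X.⁻¹)
        ≡⟨ cong (X._∘ (F₁ F a X.∘ ε e X.⁻¹)) (GPX.idTo-∘ (≈₀ F≈K c) δ (Lift.cod-eq L)) ⟩
      idTo X (Lift.cod-eq L) X.∘ (F₁ F a X.∘ ε e X.⁻¹)
        ≡⟨ X.assoc _ _ _ ⟨
      (idTo X (Lift.cod-eq L) X.∘ F₁ F a) X.∘ ε e X.⁻¹
        ≡⟨ cong (X._∘ ε e X.⁻¹) (Lift.arr-eq L) ⟩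
      (k X.∘ ε e) X.∘ ε e X.⁻¹
        ≡⟨ GPX.cancelʳ (ε e) k ⟩
      k ∎
  trivial : ∀ e → IsTrivialLift (lift′ e X.id)
  trivial e = lift-idTo fib e (≈₀ F≈K e) (X.idˡ _)

𝒢-∘ : ∀ {X Y Z} {g : Functor Y Z} {f : Functor X Y} → 𝒢 g → 𝒢 f → 𝒢 (g ∘F f)
𝒢-∘ {X} {Y} {Z} {g} {f} g-fib f-fib = mk𝒢 lift trivial
  where
  module Z = Groupoid Z
  module GPZ = GroupoidProperties Z
  module G = NormalClovenFibration g-fib
  module F = NormalClovenFibration f-fib
  lift : ∀ e {z} (k : Z.Hom (F₀ g (F₀ f e)) z) → Lift (g ∘F f) e k
  lift e k = record { cod = Lift.cod L₂ ; cod-eq = trans (cong (F₀ g) c₂) c₁ ; arr = Lift.arr L₂ ; arr-eq = arr-eq }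
    where
    L₁ = G.lift (F₀ f e) k
    L₂ = F.lift e (Lift.arr L₁)
    c₁ = Lift.cod-eq L₁
    c₂ = Lift.cod-eq L₂
    open ≡-Reasoning
    arr-eq : idTo Z (trans (cong (F₀ g) c₂) c₁) Z.∘ F₁ g (F₁ f (Lift.arr L₂)) ≡ k
    arr-eq = begin
      idTo Z (trans (cong (F₀ g) c₂) c₁) Z.∘ F₁ g (F₁ f (Lift.arr L₂))
        ≡⟨ cong (Z._∘ F₁ g (F₁ f (Lift.arr L₂))) (GPZ.idTo-trans (cong (F₀ g) c₂) c₁) ⟩
      (idTo Z c₁ Z.∘ idTo Z (cong (F₀ g) c₂)) Z.∘ F₁ g (F₁ f (Lift.arr L₂))
        ≡⟨ Z.assoc _ _ _ ⟩
      idTo Z c₁ Z.∘ (idTo Z (cong (F₀ g) c₂) Z.∘ F₁ g (F₁ f (Lift.arr L₂)))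
        ≡⟨ cong (λ u → idTo Z c₁ Z.∘ (u Z.∘ F₁ g (F₁ f (Lift.arr L₂)))) (FunctorProperties.F-idTo g c₂) ⟨
      idTo Z c₁ Z.∘ (F₁ g (idTo Y c₂) Z.∘ F₁ g (F₁ f (Lift.arr L₂)))
        ≡⟨ cong (idTo Z c₁ Z.∘_) (Functor.F-∘ g _ _) ⟨
      idTo Z c₁ Z.∘ F₁ g (Groupoid._∘_ Y (idTo Y c₂) (F₁ f (Lift.arr L₂)))
        ≡⟨ cong (λ u → idTo Z c₁ Z.∘ F₁ g u) (Lift.arr-eq L₂) ⟩
      idTo Z c₁ Z.∘ F₁ g (Lift.arr L₁)
        ≡⟨ Lift.arr-eq L₁ ⟩
      k ∎
  trivial : ∀ e → IsTrivialLift (lift e Z.id)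
  trivial e = proj₁ trivial₂ , proj₂ trivial₂
    where
    trivial₁ = lift-idTo g-fib (F₀ f e) refl refl
    trivial₂ = lift-idTo f-fib e (sym (proj₁ trivial₁)) (proj₂ trivial₁)

𝒢-iso : ∀ {X Y} (F : Functor X Y) → IsIso F → 𝒢 F
𝒢-iso {X} {Y} F iso = mk𝒢 lift trivial
  where
  module X = Groupoid X
  module Y = Groupoid Y
  module GPY = GroupoidProperties Y
  open IsIso iso
  unit : ∀ e → X.Hom e (F₀ inv (F₀ F e))
  unit e = idTo X (sym (≈₀ inv-l e))
  lift : ∀ e {y} (k : Y.Hom (F₀ F e) y) → Lift F e k
  lift e {y} k = record
    { cod = F₀ inv y ; cod-eq = ≈₀ inv-r y ; arr = F₁ inv k X.∘ unit e ; arr-eq = arr-eq }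
    where
    open ≡-Reasoning
    arr-eq : idTo Y (≈₀ inv-r y) Y.∘ F₁ F (F₁ inv k X.∘ unit e) ≡ k
    arr-eq = begin
      idTo Y (≈₀ inv-r y) Y.∘ F₁ F (F₁ inv k X.∘ unit e)
        ≡⟨ cong (idTo Y (≈₀ inv-r y) Y.∘_) (Functor.F-∘ F _ _) ⟩
      idTo Y (≈₀ inv-r y) Y.∘ (F₁ F (F₁ inv k) Y.∘ F₁ F (unit e))
        ≡⟨ Y.assoc _ _ _ ⟨
      (idTo Y (≈₀ inv-r y) Y.∘ F₁ F (F₁ inv k)) Y.∘ F₁ F (unit e)
        ≡⟨ cong (Y._∘ F₁ F (unit e)) (≈₁ inv-r k) ⟨
      (k Y.∘ idTo Y (≈₀ inv-r (F₀ F e))) Y.∘ F₁ F (unit e)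
        ≡⟨ Y.assoc _ _ _ ⟩
      k Y.∘ (idTo Y (≈₀ inv-r (F₀ F e)) Y.∘ F₁ F (unit e))
        ≡⟨ cong (λ u → k Y.∘ (idTo Y (≈₀ inv-r (F₀ F e)) Y.∘ u)) (FunctorProperties.F-idTo F (sym (≈₀ inv-l e))) ⟩
      k Y.∘ (idTo Y (≈₀ inv-r (F₀ F e)) Y.∘ idTo Y (cong (F₀ F) (sym (≈₀ inv-l e))))
        ≡⟨ cong (k Y.∘_) (GPY.idTo-∘ (cong (F₀ F) (sym (≈₀ inv-l e))) (≈₀ inv-r (F₀ F e)) refl) ⟩
      k Y.∘ Y.id
        ≡⟨ Y.idʳ k ⟩
      k ∎
  trivial : ∀ e → IsTrivialLift (lift e Y.id)
  trivial e = ≈₀ inv-l e , trans (cong (X._∘ unit e) (Functor.F-id inv)) (X.idˡ _)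

terminal-arrow-idTo : ∀ {T} → IsTerminal T → ∀ {a b} (k : Groupoid.Hom T a b) → Σ[ s ∈ a ≡ b ] k ≡ idTo T s
terminal-arrow-idTo {T} terminal {a} {b} k =
  trans (≈₀ (contract b) a) (sym (≈₀ (contract b) b)) ,
  trans (≈⇒conj (≈-sym (contract b)) k) (conj-idTo-id (≈₀ (contract b) a) (≈₀ (contract b) b))
  where
  open IsTerminal terminal
  open GroupoidProperties T
  constant : Groupoid.Ob T → Functor T T
  constant t = record
    { F₀ = λ _ → t ; F₁ = λ _ → Groupoid.id T ; F-id = refl ; F-∘ = λ _ _ → sym (Groupoid.idˡ T _) }
  contract : (t : Groupoid.Ob T) → Id T ≈ constant t
  contract t = ≈-trans (!-unique (Id T)) (≈-sym (!-unique (constant t)))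

𝒢-terminal : ∀ {X T} → IsTerminal T → (f : Functor X T) → 𝒢 f
𝒢-terminal {X} {T} terminal f = mk𝒢 lift (λ _ → refl , refl)
  where
  lift : ∀ e {t} (k : Groupoid.Hom T (F₀ f e) t) → Lift f e k
  lift e k = record
    { cod = e ; cod-eq = proj₁ (terminal-arrow-idTo terminal k) ; arr = Groupoid.id X
    ; arr-eq = trans (cong (Groupoid._∘_ T _) (Functor.F-id f))
                     (trans (Groupoid.idʳ T _) (sym (proj₂ (terminal-arrow-idTo terminal k)))) }

𝒢-π₁ : ∀ {X Y Z} (f : Functor X Z) (g : Functor Y Z) → 𝒢 g → 𝒢 (StrictPullback.π₁ f g)
𝒢-π₁ {X} {Y} {Z} f g g-fib = mk𝒢 lift trivial
  where
  open StrictPullback f g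
  module X = Groupoid X
  module Z = Groupoid Z
  module GPZ = GroupoidProperties Z
  module G = NormalClovenFibration g-fib
  base : ∀ s {x′} (h : X.Hom (ob₁ s) x′) → Z.Hom (F₀ g (ob₂ s)) (F₀ f x′)
  base s h = F₁ f h Z.∘ idTo Z (sym (glue s))
  lift : ∀ s {x′} (h : X.Hom (ob₁ s) x′) → Lift π₁ s h
  lift s {x′} h = record
    { cod = object x′ (Lift.cod L) (sym (Lift.cod-eq L)) ; cod-eq = refl
    ; arr = arrow h (Lift.arr L) (GPZ.conj⇒square over) ; arr-eq = X.idˡ h }
    where
    L = G.lift (ob₂ s) (base s h)
    over : F₁ g (Lift.arr L) ≡ GPZ.conj (idTo Z (glue s)) (idTo Z (sym (Lift.cod-eq L))) (F₁ f h)
    over = trans (GPZ.idTo-moveˡ (Lift.cod-eq L) (Lift.arr-eq L))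
                 (cong (λ u → idTo Z (sym (Lift.cod-eq L)) Z.∘ (F₁ f h Z.∘ u)) (GPZ.idTo-sym (glue s)))
  trivial : ∀ s → IsTrivialLift (lift s X.id)
  trivial s = ρ , Arrow-≡ (sym (ar₁-idTo (sym ρ) refl))
                          (trans (proj₂ L-trivial) (sym (ar₂-idTo (sym ρ) (sym (proj₁ L-trivial)))))
    where
    L-trivial = lift-idTo g-fib (ob₂ s) (sym (glue s)) (trans (cong (Z._∘ _) (Functor.F-id f)) (Z.idˡ _))
    ρ = Object-≡ refl (proj₁ L-trivial)

𝒢-baseChange : ∀ {X E Y P} (f : Functor X Y) (p : Functor E Y) (π₁ : Functor P X) (π₂ : Functor P E) →
               IsPullback f p π₁ π₂ → 𝒢 p → 𝒢 π₁
𝒢-baseChange f p π₁ π₂ pb p-fib = 𝒢-resp-≈ π₁-to (𝒢-∘ (𝒢-π₁ f p p-fib) (𝒢-iso to to-iso))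
  where open PullbackComparison pb

gpdTribe : Tribe 𝒢
gpdTribe = record
  { ⊤ = 𝟙 ; ⊤-terminal = 𝟙-terminal
  ; pb = λ f g _ → StrictPullback.pullback f g
  ; 𝒜-∘ = 𝒢-∘ ; 𝒜-bc = 𝒢-baseChange ; 𝒜-iso = 𝒢-iso ; 𝒜-term = 𝒢-terminal }

record StrongDeformationRetract {A B : Groupoid} (i : Functor A B) : Set where
  private
    module A = Groupoid A
    module B = Groupoid B
    module GPA = GroupoidProperties A
  field
    retraction : Functor B A
    retraction∘i : retraction ∘F i ≈ Id A
    η            : ∀ b → B.Hom b (F₀ i (F₀ retraction b))
    η-natural    : ∀ {b b′} (f : B.Hom b b′) → F₁ i (F₁ retraction f) B.∘ η b ≡ η b′ B.∘ f
    η-on-image   : ∀ a → η (F₀ i a) ≡ idTo B (cong (F₀ i) (sym (≈₀ retraction∘i a)))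

  η-idTo : ∀ {b a} → b ≡ F₀ i a → Σ[ s ∈ b ≡ F₀ i (F₀ retraction b) ] η b ≡ idTo B s
  η-idTo {a = a} refl = cong (F₀ i) (sym (≈₀ retraction∘i a)) , η-on-image a

  retraction-conj : ∀ {b b′ a a′} (c : b ≡ F₀ i a) (c′ : b′ ≡ F₀ i a′) {x : B.Hom b b′} {g : A.Hom a a′} →
                    F₁ i g B.∘ idTo B c ≡ idTo B c′ B.∘ x →
                    g ≡ GPA.conj (idTo A (trans (cong (F₀ retraction) c) (≈₀ retraction∘i a)))
                                 (idTo A (trans (cong (F₀ retraction) c′) (≈₀ retraction∘i a′)))
                                 (F₁ retraction x)
  retraction-conj refl refl {x} {g} sq =
    trans (≈⇒conj retraction∘i g) (cong (λ k → GPA.conj _ _ (F₁ retraction k)) ig≡x)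
    where
    ig≡x : F₁ i g ≡ x
    ig≡x = trans (sym (B.idʳ _)) (trans sq (B.idˡ x))

module SDR-Lifting {A B : Groupoid} {i : Functor A B} (sdr : StrongDeformationRetract i)
                   {S U : Groupoid} {h : Functor S U} (h-fib : 𝒢 h)
                   (u : Functor A S) (v : Functor B U) (γ : h ∘F u ≈ v ∘F i) where
  open StrongDeformationRetract sdr
  private
    module A = Groupoid A
    module B = Groupoid B
    module U = Groupoid U
    module GPA = GroupoidProperties A
    module GPB = GroupoidProperties B
    module GPS = GroupoidProperties S
    module GPU = GroupoidProperties U
    module H = NormalClovenFibration h-fib

  ur : Functor B S
  ur = u ∘F retraction

  κ : ∀ b → U.Hom (F₀ h (F₀ ur b)) (F₀ v b)
  κ b = F₁ v (η b B.⁻¹) U.∘ idTo U (≈₀ γ (F₀ retraction b))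

  L : ∀ b → Lift h (F₀ ur b) (κ b)
  L b = H.lift (F₀ ur b) (κ b)

  -- u ∘ retraction, moved along the chosen lifts of the arrows κ b so that it lies over v
  D : Functor B S
  D = conjugate ur (λ b → Lift.arr (L b))

  h∘D≈v : h ∘F D ≈ v
  h∘D≈v = conj⇒≈ (λ b → Lift.cod-eq (L b)) (λ f → sym (chain f))
    where
    open ≡-Reasoning
    chain : ∀ {b b′} (f : B.Hom b b′) →
            GPU.conj (idTo U (Lift.cod-eq (L b))) (idTo U (Lift.cod-eq (L b′))) (F₁ h (F₁ D f)) ≡ F₁ v f
    chain {b} {b′} f = begin
      GPU.conj (idTo U (Lift.cod-eq (L b))) (idTo U (Lift.cod-eq (L b′))) (F₁ h (F₁ D f))
        ≡⟨ GPU.conj-cong refl refl (FunctorProperties.F-conj h _ _ (F₁ ur f)) ⟩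
      GPU.conj (idTo U (Lift.cod-eq (L b))) (idTo U (Lift.cod-eq (L b′)))
        (GPU.conj (F₁ h (Lift.arr (L b))) (F₁ h (Lift.arr (L b′))) (F₁ h (F₁ ur f)))
        ≡⟨ GPU.conj-conj _ _ _ _ _ ⟩
      GPU.conj (idTo U (Lift.cod-eq (L b)) U.∘ F₁ h (Lift.arr (L b)))
               (idTo U (Lift.cod-eq (L b′)) U.∘ F₁ h (Lift.arr (L b′))) (F₁ h (F₁ ur f))
        ≡⟨ GPU.conj-cong (Lift.arr-eq (L b)) (Lift.arr-eq (L b′)) refl ⟩
      GPU.conj (κ b) (κ b′) (F₁ h (F₁ ur f))
        ≡⟨ GPU.conj-conj _ _ _ _ _ ⟨
      GPU.conj (F₁ v (η b B.⁻¹)) (F₁ v (η b′ B.⁻¹))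
        (GPU.conj (idTo U (≈₀ γ (F₀ retraction b))) (idTo U (≈₀ γ (F₀ retraction b′))) (F₁ h (F₁ ur f)))
        ≡⟨ GPU.conj-cong refl refl (≈⇒conj γ (F₁ retraction f)) ⟨
      GPU.conj (F₁ v (η b B.⁻¹)) (F₁ v (η b′ B.⁻¹)) (F₁ v (F₁ i (F₁ retraction f)))
        ≡⟨ FunctorProperties.F-conj v _ _ _ ⟨
      F₁ v (GPB.conj (η b B.⁻¹) (η b′ B.⁻¹) (F₁ i (F₁ retraction f)))
        ≡⟨ cong (λ k → F₁ v (GPB.conj (η b B.⁻¹) (η b′ B.⁻¹) k)) (GPB.square⇒conj (η-natural f)) ⟩
      F₁ v (GPB.conj (η b B.⁻¹) (η b′ B.⁻¹) (GPB.conj (η b) (η b′) f))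
        ≡⟨ cong (F₁ v) (GPB.conj-cancel (η b) (η b′) f) ⟩
      F₁ v f ∎

  κ-on-image : ∀ a → Σ[ s ∈ F₀ h (F₀ ur (F₀ i a)) ≡ F₀ v (F₀ i a) ] κ (F₀ i a) ≡ idTo U s
  κ-on-image a = trans γ₀ (cong (F₀ v) (sym s)) , (begin
    F₁ v (η (F₀ i a) B.⁻¹) U.∘ idTo U γ₀    ≡⟨ cong (λ k → F₁ v (k B.⁻¹) U.∘ idTo U γ₀) (η-on-image a) ⟩
    F₁ v (idTo B s B.⁻¹) U.∘ idTo U γ₀      ≡⟨ cong (λ k → F₁ v k U.∘ idTo U γ₀) (GPB.idTo-sym s) ⟨
    F₁ v (idTo B (sym s)) U.∘ idTo U γ₀     ≡⟨ cong (U._∘ idTo U γ₀) (FunctorProperties.F-idTo v (sym s)) ⟩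
    idTo U (cong (F₀ v) (sym s)) U.∘ idTo U γ₀ ≡⟨ GPU.idTo-trans γ₀ (cong (F₀ v) (sym s)) ⟨
    idTo U (trans γ₀ (cong (F₀ v) (sym s))) ∎)
    where
    open ≡-Reasoning
    s = cong (F₀ i) (sym (≈₀ retraction∘i a))
    γ₀ = ≈₀ γ (F₀ retraction (F₀ i a))

  D∘i≈u : D ∘F i ≈ u
  D∘i≈u = conj⇒≈ e (λ f → sym (chain f))
    where
    trivial : ∀ a → IsTrivialLift (L (F₀ i a))
    trivial a = lift-idTo h-fib _ (proj₁ (κ-on-image a)) (proj₂ (κ-on-image a))
    e : ∀ a → F₀ D (F₀ i a) ≡ F₀ u a
    e a = trans (proj₁ (trivial a)) (cong (F₀ u) (≈₀ retraction∘i a))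
    open ≡-Reasoning
    chain : ∀ {a a′} (f : A.Hom a a′) →
            GPS.conj (idTo S (e a)) (idTo S (e a′)) (F₁ D (F₁ i f)) ≡ F₁ u f
    chain {a} {a′} f = begin
      GPS.conj (idTo S (e a)) (idTo S (e a′)) (F₁ D (F₁ i f))
        ≡⟨ GPS.conj-cong refl refl (GPS.conj-cong (proj₂ (trivial a)) (proj₂ (trivial a′)) refl) ⟩
      GPS.conj (idTo S (e a)) (idTo S (e a′))
        (GPS.conj (idTo S (sym (proj₁ (trivial a)))) (idTo S (sym (proj₁ (trivial a′)))) (F₁ ur (F₁ i f)))
        ≡⟨ GPS.conj-idTo-conj (sym (proj₁ (trivial a))) (sym (proj₁ (trivial a′))) (e a) (e a′)
                              (cong (F₀ u) (≈₀ retraction∘i a)) (cong (F₀ u) (≈₀ retraction∘i a′)) _ ⟩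
      GPS.conj (idTo S (cong (F₀ u) (≈₀ retraction∘i a))) (idTo S (cong (F₀ u) (≈₀ retraction∘i a′)))
        (F₁ u (F₁ retraction (F₁ i f)))
        ≡⟨ GPS.conj-cong (FunctorProperties.F-idTo u (≈₀ retraction∘i a))
                         (FunctorProperties.F-idTo u (≈₀ retraction∘i a′)) refl ⟨
      GPS.conj (F₁ u (idTo A (≈₀ retraction∘i a))) (F₁ u (idTo A (≈₀ retraction∘i a′)))
        (F₁ u (F₁ retraction (F₁ i f)))
        ≡⟨ FunctorProperties.F-conj u _ _ _ ⟨
      F₁ u (GPA.conj (idTo A (≈₀ retraction∘i a)) (idTo A (≈₀ retraction∘i a′)) (F₁ retraction (F₁ i f)))
        ≡⟨ cong (F₁ u) (≈⇒conj retraction∘i f) ⟨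
      F₁ u f ∎

SDR-LLP : ∀ {A B S U} {i : Functor A B} {h : Functor S U} → StrongDeformationRetract i → 𝒢 h → LLP i h
SDR-LLP sdr h-fib u v γ = D , D∘i≈u , h∘D≈v
  where open SDR-Lifting sdr h-fib u v γ

module SDR-BaseChange {A B Z : Groupoid} {i : Functor A B} (sdr : StrongDeformationRetract i)
                      {q : Functor Z B} (q-fib : 𝒢 q) where
  open StrongDeformationRetract sdr
  open StrictPullback q i
  private
    module B = Groupoid B
    module Z = Groupoid Z
    module GPA = GroupoidProperties A
    module GPB = GroupoidProperties B
    module GPZ = GroupoidProperties Z
    module Q = NormalClovenFibration q-fib

  η-lift : ∀ z → Lift q z (η (F₀ q z))
  η-lift z = Q.lift z (η (F₀ q z))
  φ : ∀ z → Z.Hom z (Lift.cod (η-lift z))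
  φ z = Lift.arr (η-lift z)

  retract : Functor Z P
  retract = pair (conjugate (Id Z) φ) (retraction ∘F q) (conj⇒≈ (λ z → Lift.cod-eq (η-lift z)) chain)
    where
    open ≡-Reasoning
    chain : ∀ {z z′} (f : Z.Hom z z′) → F₁ i (F₁ retraction (F₁ q f)) ≡
            GPB.conj (idTo B (Lift.cod-eq (η-lift z))) (idTo B (Lift.cod-eq (η-lift z′))) (F₁ q (GPZ.conj (φ z) (φ z′) f))
    chain {z} {z′} f = sym (begin
      GPB.conj (idTo B (Lift.cod-eq (η-lift z))) (idTo B (Lift.cod-eq (η-lift z′))) (F₁ q (GPZ.conj (φ z) (φ z′) f))
        ≡⟨ GPB.conj-cong refl refl (FunctorProperties.F-conj q (φ z) (φ z′) f) ⟩
      GPB.conj (idTo B (Lift.cod-eq (η-lift z))) (idTo B (Lift.cod-eq (η-lift z′)))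
        (GPB.conj (F₁ q (φ z)) (F₁ q (φ z′)) (F₁ q f))
        ≡⟨ GPB.conj-conj _ _ _ _ _ ⟩
      GPB.conj (idTo B (Lift.cod-eq (η-lift z)) B.∘ F₁ q (φ z))
               (idTo B (Lift.cod-eq (η-lift z′)) B.∘ F₁ q (φ z′)) (F₁ q f)
        ≡⟨ GPB.conj-cong (Lift.arr-eq (η-lift z)) (Lift.arr-eq (η-lift z′)) refl ⟩
      GPB.conj (η (F₀ q z)) (η (F₀ q z′)) (F₁ q f)
        ≡⟨ GPB.square⇒conj (η-natural (F₁ q f)) ⟨
      F₁ i (F₁ retraction (F₁ q f)) ∎)

  η-lift-trivial : ∀ w → IsTrivialLift (η-lift (ob₁ w))
  η-lift-trivial w = lift-idTo q-fib (ob₁ w) (proj₁ (η-idTo (glue w))) (proj₂ (η-idTo (glue w)))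

  η-lift-cod : ∀ w → Lift.cod (η-lift (ob₁ w)) ≡ ob₁ w
  η-lift-cod w = proj₁ (η-lift-trivial w)

  retraction-ob₂ : ∀ w → F₀ retraction (F₀ q (ob₁ w)) ≡ ob₂ w
  retraction-ob₂ w = trans (cong (F₀ retraction) (glue w)) (≈₀ retraction∘i (ob₂ w))

  retract-ob : ∀ w → F₀ retract (ob₁ w) ≡ w
  retract-ob w = Object-≡ (η-lift-cod w) (retraction-ob₂ w)

  φ-on-image : ∀ w → φ (ob₁ w) ≡ idTo Z (cong ob₁ (sym (retract-ob w)))
  φ-on-image w = trans (proj₂ (η-lift-trivial w))
                       (cong (idTo Z) (uip (sym (η-lift-cod w)) (cong ob₁ (sym (retract-ob w)))))

  retract∘π₁ : retract ∘F π₁ ≈ Id P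
  retract∘π₁ = conj⇒≈ retract-ob arrows
    where
    open ≡-Reasoning
    arrows : ∀ {w w′} (k : Arrow w w′) →
             k ≡ GroupoidProperties.conj P (idTo P (retract-ob w)) (idTo P (retract-ob w′)) (F₁ retract (ar₁ k))
    arrows {w} {w′} k = Arrow-≡
      (sym (begin
        GPZ.conj (ar₁ (idTo P (retract-ob w))) (ar₁ (idTo P (retract-ob w′))) (GPZ.conj (φ (ob₁ w)) (φ (ob₁ w′)) (ar₁ k))
          ≡⟨ GPZ.conj-cong (ar₁-idTo (retract-ob w) (η-lift-cod w)) (ar₁-idTo (retract-ob w′) (η-lift-cod w′))
                           (GPZ.conj-cong (proj₂ (η-lift-trivial w)) (proj₂ (η-lift-trivial w′)) refl) ⟩
        GPZ.conj (idTo Z (η-lift-cod w)) (idTo Z (η-lift-cod w′))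
          (GPZ.conj (idTo Z (sym (η-lift-cod w))) (idTo Z (sym (η-lift-cod w′))) (ar₁ k))
          ≡⟨ GPZ.conj-idTo-conj (sym (η-lift-cod w)) (sym (η-lift-cod w′)) (η-lift-cod w) (η-lift-cod w′)
                                refl refl (ar₁ k) ⟩
        GPZ.conj Z.id Z.id (ar₁ k)
          ≡⟨ GPZ.conj-idid (ar₁ k) ⟩
        ar₁ k ∎))
      (trans (retraction-conj (glue w) (glue w′) (square k))
             (sym (GPA.conj-cong (ar₂-idTo (retract-ob w) (retraction-ob₂ w))
                                 (ar₂-idTo (retract-ob w′) (retraction-ob₂ w′)) refl)))

SDR-baseChange : ∀ {A B Z : Groupoid} {i : Functor A B} {q : Functor Z B} →
                 StrongDeformationRetract i → 𝒢 q → StrongDeformationRetract (StrictPullback.π₁ q i)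
SDR-baseChange {Z = Z} sdr q-fib = record
  { retraction = retract
  ; retraction∘i = retract∘π₁
  ; η = φ
  ; η-natural = λ {z} {z′} f → GroupoidProperties.conj-square Z (φ z) (φ z′) f
  ; η-on-image = φ-on-image }
  where open SDR-BaseChange sdr q-fib

module PathGroupoid {E Y : Groupoid} (p : Functor E Y) where
  private
    module E = Groupoid E
    module Y = Groupoid Y
    module GPE = GroupoidProperties E
    module GPY = GroupoidProperties Y
  module E×E = StrictPullback p p

  record VerticalIso : Set where
    constructor vertical
    field
      source target : E.Ob
      iso           : E.Hom source target
      base          : F₀ p source ≡ F₀ p target
      iso-over      : F₁ p iso ≡ idTo Y base
  open VerticalIso public

  VerticalIso-≡ : ∀ {V W} (s : source V ≡ source W) (t : target V ≡ target W) →
                  iso W E.∘ idTo E s ≡ idTo E t E.∘ iso V → V ≡ W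
  VerticalIso-≡ {vertical a b u c o} {vertical .a .b u′ c′ o′} refl refl sq
    with trans (sym (E.idʳ u′)) (trans sq (E.idˡ u)) | uip c c′
  ... | refl | refl = cong (vertical a b u′ c) (uip o o′)

  -- An arrow V → W is an arrow between the sources: the arrow between the
  -- targets is then forced, namely its conjugate by iso V and iso W.
  Path : Groupoid
  Path = record
    { Ob = VerticalIso ; Hom = λ V W → E.Hom (source V) (source W)
    ; id = E.id ; _∘_ = E._∘_ ; _⁻¹ = E._⁻¹
    ; idˡ = E.idˡ ; idʳ = E.idʳ ; assoc = E.assoc ; invˡ = E.invˡ ; invʳ = E.invʳ
    ; Ob-set = uip ; Hom-set = E.Hom-set }

  idTo-Path : ∀ {V W} (e : V ≡ W) → idTo Path e ≡ idTo E (cong source e)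
  idTo-Path refl = refl

  r : Functor E Path
  r = record
    { F₀ = λ e → vertical e e E.id refl (Functor.F-id p) ; F₁ = λ a → a ; F-id = refl ; F-∘ = λ _ _ → refl }

  ev₀ : Functor Path E
  ev₀ = record { F₀ = source ; F₁ = λ a → a ; F-id = refl ; F-∘ = λ _ _ → refl }

  ev₁ : Functor Path E
  ev₁ = conjugate ev₀ iso

  ∂ : Functor Path E×E.P
  ∂ = E×E.pair ev₀ ev₁ (conj⇒≈ base (λ {V} {W} → over {V} {W}))
    where
    over : ∀ {V W} (a : E.Hom (source V) (source W)) →
           F₁ p (F₁ ev₁ {V} {W} a) ≡ GPY.conj (idTo Y (base V)) (idTo Y (base W)) (F₁ p a)
    over {V} {W} a = trans (FunctorProperties.F-conj p (iso V) (iso W) a)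
                           (GPY.conj-cong (iso-over V) (iso-over W) refl)

  ∂∘r-diagonal : (E×E.π₁ ∘F (∂ ∘F r) ≈ Id E) × (E×E.π₂ ∘F (∂ ∘F r) ≈ Id E)
  ∂∘r-diagonal = record { ≈₀ = λ _ → refl ; ≈₁ = λ _ → GPE.id-square _ }
               , ≈-sym (conj⇒≈ (λ _ → refl) (λ _ → refl))

  ∂-fibration : 𝒢 ∂
  ∂-fibration = mk𝒢 lift trivial
    where
    lift : ∀ V {x} (k : E×E.Arrow (F₀ ∂ V) x) → Lift ∂ V k
    lift V {E×E.object y₀ y₁ c} (E×E.arrow a₀ a₁ sq) = record
      { cod = vertical y₀ y₁ (GPE.conj a₀ a₁ (iso V)) c over
      ; cod-eq = refl
      ; arr = a₀
      ; arr-eq = E×E.Arrow-≡ (E.idˡ a₀)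
                   (trans (E.idˡ _) (sym (GPE.square⇒conj (sym (GPE.conj-square a₀ a₁ (iso V)))))) }
      where
      over : F₁ p (GPE.conj a₀ a₁ (iso V)) ≡ idTo Y c
      over = trans (FunctorProperties.F-conj p a₀ a₁ (iso V))
               (trans (GPY.conj-cong refl refl (iso-over V)) (sym (GPY.square⇒conj (sym sq))))
    trivial : ∀ V → IsTrivialLift (lift V (Groupoid.id E×E.P))
    trivial V = ρ , sym (trans (idTo-Path (sym ρ)) (GPE.idTo-loop (cong source (sym ρ))))
      where
      ρ = VerticalIso-≡ refl refl (trans (E.idʳ _) (trans (sym (GPE.conj-idid (iso V))) (sym (E.idˡ _))))

  r-SDR : StrongDeformationRetract r
  r-SDR = record
    { retraction = ev₀
    ; retraction∘i = record { ≈₀ = λ _ → refl ; ≈₁ = λ _ → GPE.id-square _ }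
    ; η = λ _ → E.id
    ; η-natural = GPE.id-square
    ; η-on-image = λ _ → refl }

gpdPathObjects : PathObjects gpdTribe
gpdPathObjects p _ = record
  { Path = Path ; r = r ; ∂ = ∂ ; fact = ∂∘r-diagonal ; ∂∈𝒜 = ∂-fibration
  ; r-llp = λ q q-fib π₁ π₂ pb g g-fib →
      PullbackComparison.LLP-transfer pb g (SDR-LLP (SDR-baseChange r-SDR q-fib) g-fib) }
  where open PathGroupoid p

module Stability {E Y X : Groupoid} (p : Functor E Y) (f : Functor X Y) where
  private
    module E = Groupoid E
    module Y = Groupoid Y
    module X = Groupoid X
    module GPE = GroupoidProperties E
    module GPY = GroupoidProperties Y
    module GPX = GroupoidProperties X
  module F = StrictPullback f p

  f*p : Functor F.P X
  f*p = F.π₁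

  p*f : Functor F.P E
  p*f = F.π₂

  module Pp = PathGroupoid p
  module Pq = PathGroupoid f*p
  module Map = StrictPullback p*f (Pp.E×E.π₁ ∘F Pp.∂)
  private
    module GPF = GroupoidProperties F.P

  extended-glue : (φ : F.Object) (V : Pp.VerticalIso) → F.ob₂ φ ≡ Pp.source V →
                  F₀ f (F.ob₁ φ) ≡ F₀ p (Pp.target V)
  extended-glue φ V c = trans (F.glue φ) (trans (cong (F₀ p) c) (Pp.base V))

  opaque
    extended-square : (φ : F.Object) (V : Pp.VerticalIso) (c : F.ob₂ φ ≡ Pp.source V) →
                      F₁ p (Pp.iso V E.∘ idTo E c) Y.∘ idTo Y (F.glue φ) ≡
                      idTo Y (extended-glue φ V c) Y.∘ F₁ f X.id
    extended-square φ V c = begin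
      F₁ p (Pp.iso V E.∘ idTo E c) Y.∘ idTo Y (F.glue φ)
        ≡⟨ cong (Y._∘ idTo Y (F.glue φ)) (Functor.F-∘ p _ _) ⟩
      (F₁ p (Pp.iso V) Y.∘ F₁ p (idTo E c)) Y.∘ idTo Y (F.glue φ)
        ≡⟨ cong (Y._∘ idTo Y (F.glue φ)) (cong₂ Y._∘_ (Pp.iso-over V) (FunctorProperties.F-idTo p c)) ⟩
      (idTo Y (Pp.base V) Y.∘ idTo Y (cong (F₀ p) c)) Y.∘ idTo Y (F.glue φ)
        ≡⟨ cong (Y._∘ idTo Y (F.glue φ)) (GPY.idTo-trans (cong (F₀ p) c) (Pp.base V)) ⟨
      idTo Y (trans (cong (F₀ p) c) (Pp.base V)) Y.∘ idTo Y (F.glue φ)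
        ≡⟨ GPY.idTo-trans (F.glue φ) _ ⟨
      idTo Y (extended-glue φ V c)
        ≡⟨ Y.idʳ _ ⟨
      idTo Y (extended-glue φ V c) Y.∘ Y.id
        ≡⟨ cong (idTo Y (extended-glue φ V c) Y.∘_) (Functor.F-id f) ⟨
      idTo Y (extended-glue φ V c) Y.∘ F₁ f X.id ∎
      where open ≡-Reasoning

  extend : Map.Object → Pq.VerticalIso
  extend (Map.object φ V c) =
    Pq.vertical φ (F.object (F.ob₁ φ) (Pp.target V) (extended-glue φ V c))
                (F.arrow X.id (Pp.iso V E.∘ idTo E c) (extended-square φ V c)) refl refl

  i : Functor Map.P Pq.Path
  i = record { F₀ = extend ; F₁ = Map.ar₁ ; F-id = refl ; F-∘ = λ _ _ → refl }

  ∂⁰∘i : Pq.E×E.π₁ ∘F Pq.∂ ∘F i ≈ Map.π₁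
  ∂⁰∘i = record { ≈₀ = λ _ → refl ; ≈₁ = λ a → GPF.id-square (Map.ar₁ a) }

  base-∂¹∘i : f*p ∘F Pq.E×E.π₂ ∘F Pq.∂ ∘F i ≈ f*p ∘F Map.π₁
  base-∂¹∘i = conj⇒≈ (λ _ → refl) (λ a → sym (trans (GPX.conj-idid _) (GPX.conj-idid _)))

  fibre-∂¹∘i : p*f ∘F Pq.E×E.π₂ ∘F Pq.∂ ∘F i ≈ (Pp.E×E.π₂ ∘F Pp.∂) ∘F Map.π₂
  fibre-∂¹∘i = conj⇒≈ (λ _ → refl) chain
    where
    open ≡-Reasoning
    chain : ∀ {m m′} (a : Map.Arrow m m′) →
            GPE.conj (Pp.iso (Map.ob₂ m)) (Pp.iso (Map.ob₂ m′)) (Map.ar₂ a) ≡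
            GPE.conj E.id E.id (F₁ (p*f ∘F Pq.E×E.π₂ ∘F Pq.∂ ∘F i) a)
    chain {m} {m′} a = begin
      GPE.conj (Pp.iso (Map.ob₂ m)) (Pp.iso (Map.ob₂ m′)) (Map.ar₂ a)
        ≡⟨ GPE.conj-cong refl refl (GPE.square⇒conj (Map.square a)) ⟩
      GPE.conj (Pp.iso (Map.ob₂ m)) (Pp.iso (Map.ob₂ m′))
        (GPE.conj (idTo E (Map.glue m)) (idTo E (Map.glue m′)) (F.ar₂ (Map.ar₁ a)))
        ≡⟨ GPE.conj-conj _ _ _ _ _ ⟩
      F₁ (p*f ∘F Pq.E×E.π₂ ∘F Pq.∂ ∘F i) a
        ≡⟨ GPE.conj-idid _ ⟨
      GPE.conj E.id E.id (F₁ (p*f ∘F Pq.E×E.π₂ ∘F Pq.∂ ∘F i) a) ∎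

  constant-paths-commute : p*f ∘F Id F.P ≈ (Pp.E×E.π₁ ∘F Pp.∂) ∘F (Pp.r ∘F p*f)
  constant-paths-commute = record { ≈₀ = λ _ → refl ; ≈₁ = λ a → GPE.id-square (F.ar₂ a) }

  constant-paths : Functor F.P Map.P
  constant-paths = Map.pair (Id F.P) (Pp.r ∘F p*f) constant-paths-commute

  i∘constant-paths≈r : i ∘F constant-paths ≈ Pq.r
  i∘constant-paths≈r = record
    { ≈₀ = e
    ; ≈₁ = λ {φ} {φ′} b →
        trans (cong (b F′.∘_) (idTo-e≡id φ)) (trans (GPF.id-square b) (cong (F′._∘ b) (sym (idTo-e≡id φ′)))) }
    where
    module F′ = Groupoid F.P
    e : ∀ φ → F₀ (i ∘F constant-paths) φ ≡ F₀ Pq.r φ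
    e φ = Pq.VerticalIso-≡ refl t (F.Arrow-≡
            (trans (X.idˡ _) (sym (trans (cong (X._∘ X.id) (F.ar₁-idTo t refl)) (X.idˡ _))))
            (trans (E.idˡ _) (sym (trans (cong (E._∘ (E.id E.∘ E.id)) (F.ar₂-idTo t refl))
                                         (trans (E.idˡ _) (E.idʳ _))))))
      where
      t : F.object (F.ob₁ φ) (F.ob₂ φ) (trans (F.glue φ) refl) ≡ φ
      t = F.Object-≡ refl refl
    idTo-e≡id : ∀ φ → idTo Pq.Path (e φ) ≡ F′.id
    idTo-e≡id φ = trans (Pq.idTo-Path (e φ)) (GPF.idTo-loop (cong Pq.source (e φ)))

  i-preserves-r : (m : Functor F.P Map.P) → Map.π₁ ∘F m ≈ Id F.P → Map.π₂ ∘F m ≈ Pp.r ∘F p*f →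
                  i ∘F m ≈ Pq.r
  i-preserves-r m α β =
    ≈-trans (∘F-congˡ i (Map.pair-unique (Id F.P) (Pp.r ∘F p*f) constant-paths-commute m α β))
            i∘constant-paths≈r

gpdStablePathObjects : StablePathObjects gpdTribe gpdPathObjects
gpdStablePathObjects p _ f = i , i-preserves-r , ∂⁰∘i , base-∂¹∘i , fibre-∂¹∘i
  where open Stability p f

theorem4p3 : Σ[ T ∈ Tribe 𝒢 ] Σ[ PO ∈ PathObjects T ] StablePathObjects T PO
theorem4p3 = gpdTribe , gpdPathObjects , gpdStablePathObjects
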